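{- Let $\lambda\neq0$ be real. For all integers $n,k\ge 0$, $$\sum_{j=0}^{n}S_{2,\lambda}^{[2]}(n-j+k,2k)\binom{n+k}{j}\beta_{j,\lambda}^{(k)}=\binom{n+k}{k}\sum_{j=0}^{k}\binom{k}{j}(-1)^{k-j}\beta_{n,\lambda}^{(k-j)}.$$
   Context: For real $x$ and nonzero real $\lambda$, $(x)_{0,\lambda}=1$ and $(x)_{n,\lambda}=x(x-\lambda)\cdots(x-(n-1)\lambda)$ for $n\ge1$; $e_\lambda(t)=(1+\lambda t)^{1/\lambda}=\sum_{k\ge0}(1)_{k,\lambda}\frac{t^k}{k!}$. The $2$-truncated degenerate Stirling numbers of the second kind are defined by $\frac{1}{k!}(e_\lambda(t)-1-t)^k=\sum_{n\ge 2k}S_{2,\lambda}^{[2]}(n,2k)\frac{t^n}{n!}$, with $S_{2,\lambda}^{[2]}(n,2k)=0$ for $0\le n<2k$. For an integer $\alpha\ge0$, the degenerate Bernoulli numbers of order $\alpha$ are defined by $\big(\frac{t}{e_\lambda(t)-1}\big)^{\alpha}=\sum_{n\ge0}\beta_{n,\lambda}^{(\alpha)}\frac{t^n}{n!}$ (so $\beta^{(0)}_{n,\lambda}$ equals $1$ if $n=0$ and $0$ otherwise).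
   Formalization: The parameter λ ranges over the nonzero rationals instead of the nonzero reals. -}

module Defs where

open import Data.Nat as ℕ using (ℕ; zero; suc; _!)
open import Data.Nat.Properties using (_!≢0)
open import Data.Nat.Combinatorics using (_C_)
open import Data.Integer using (+_)
open import Data.List using (List; []; _∷_; map; zipWith; foldr; length)
open import Data.Rational using (ℚ; 0ℚ; 1ℚ; _+_; _*_; _-_; -_; _/_)

fromℕ : ℕ → ℚ
fromℕ n = (+ n) / 1

invFact : ℕ → ℚ
invFact m = ((+ 1) / (m !)) {{m !≢0}}

signPow : ℕ → ℚ
signPow zero = 1ℚ
signPow (suc m) = - signPow m

sumTo : ℕ → (ℕ → ℚ) → ℚ
sumTo zero f = f 0
sumTo (suc n) f = sumTo n f + f (suc n)

dfall : ℚ → ℚ → ℕ → ℚ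
dfall x lam zero = 1ℚ
dfall x lam (suc n) = dfall x lam n * (x - fromℕ n * lam)

-- formal power series over ℚ, represented by their (ordinary) coefficient sequences
Series : Set
Series = ℕ → ℚ

_⊛_ : Series → Series → Series
(f ⊛ g) n = sumTo n (λ i → f i * g (n ℕ.∸ i))

one : Series
one zero = 1ℚ
one (suc n) = 0ℚ

pow : Series → ℕ → Series
pow f zero = one
pow f (suc k) = pow f k ⊛ f

-- multiplicative inverse of a series with constant term 1:
-- d_0 = 1, d_n = - Σ_{i=1}^{n} c_i d_{n-i}.
-- invRev c n is the list [d_n, d_{n-1}, ..., d_0].
invRev : Series → ℕ → List ℚ
invRev c zero = 1ℚ ∷ []
invRev c (suc n) with invRev c n
... | ds = (- foldr _+_ 0ℚ (zipWith _*_ (map c (upFrom1 (length ds))) ds)) ∷ ds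
  where
  upFrom1 : ℕ → List ℕ
  upFrom1 m = go m []
    where
    go : ℕ → List ℕ → List ℕ
    go zero acc = acc
    go (suc m) acc = go m (suc m ∷ acc)

headOr0 : List ℚ → ℚ
headOr0 [] = 0ℚ
headOr0 (x ∷ _) = x

invSeries : Series → Series
invSeries c n = headOr0 (invRev c n)

eλ : ℚ → Series
eλ lam k = dfall 1ℚ lam k * invFact k

eλ-1-t : ℚ → Series
eλ-1-t lam zero = 0ℚ
eλ-1-t lam (suc zero) = eλ lam 1 - 1ℚ
eλ-1-t lam (suc (suc m)) = eλ lam (suc (suc m))

eλ-1/t : ℚ → Series
eλ-1/t lam m = eλ lam (suc m)

-- S^{[2]}_{2,λ}(n, 2k) : n! [t^n] (1/k!) (e_λ(t) - 1 - t)^k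
S22 : ℚ → ℕ → ℕ → ℚ
S22 lam n k = fromℕ (n !) * (invFact k * pow (eλ-1-t lam) k n)

β : ℚ → ℕ → ℕ → ℚ
β lam α n = fromℕ (n !) * pow (invSeries (eλ-1/t lam)) α n

binom : ℕ → ℕ → ℚ
binom n k = fromℕ (n C k)

-- With h = (e_λ(t) - 1) / t and u = 1 / h = t / (e_λ(t) - 1) we have β^{(k)}_{j,λ} = j! [t^j] u^k,
-- and k! S^{[2]}_{2,λ}(m, 2k) = m! [t^m] g^k for g = e_λ(t) - 1 - t = t (h - 1).  Hence u g = t (1 - u)
-- and u^k g^k = t^k (1 - u)^k.  As g^k = O(t^k), the summand with index j of the left-hand side is
-- (n+k)!/k! · [t^j] u^k · [t^{n+k-j}] g^k, and the indices j > n would contribute nothing, so the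
-- left-hand side is (n+k)!/k! · [t^{n+k}] u^k g^k = (n+k)!/k! · [t^n] (1 - u)^k.  Expanding (1 - u)^k
-- binomially gives the right-hand side, since (n+k)!/k! = C(n+k, k) n!.  The argument never uses λ ≠ 0.

module Submission where

open import Defs
open import Data.Nat as ℕ using (ℕ; zero; suc; _+_; _∸_; _≤_; _<_; _!; z≤n; s≤s)
import Data.Nat.Properties as ℕ
open import Data.Nat.Combinatorics
  using (_C_; nCk+nC[k+1]≡[n+1]C[k+1]; k>n⇒nCk≡0; nCk≡nC[n∸k]; nCk≡n!/k![n-k]!; k![n∸k]!∣n!)
open import Data.Nat.DivMod using (m/n*n≡m)
import Data.Integer as ℤ
import Data.Integer.Properties as ℤ
open import Data.Rational as ℚ using (ℚ; 0ℚ; 1ℚ; _*_; _-_; -_; _/_; toℚᵘ)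
import Data.Rational.Properties as ℚ
open import Data.Rational.Unnormalised as ℚᵘ using (mkℚᵘ; *≡*)
import Data.Rational.Unnormalised.Properties as ℚᵘ
open import Data.Rational.Solver using (module +-*-Solver)
open import Data.List using (List; []; _∷_; _++_; _∷ʳ_; map; zipWith; foldr; length; applyUpTo; applyDownFrom)
import Data.List.Properties as List
open import Function using (_∘_)
open import Relation.Binary.PropositionalEquality
import Relation.Binary.Reasoning.Setoid as SetoidReasoning

open +-*-Solver using (solve; _:+_; _:*_; :-_; _:=_)

module ≗-Reasoning = SetoidReasoning (ℕ →-setoid ℚ)

toℚᵘ-fromℕ : ∀ n → toℚᵘ (fromℕ n) ℚᵘ.≃ mkℚᵘ (ℤ.+ n) 0
toℚᵘ-fromℕ n = ℚ.toℚᵘ-fromℚᵘ (mkℚᵘ (ℤ.+ n) 0)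

fromℕ-+ : ∀ m n → fromℕ (m + n) ≡ fromℕ m ℚ.+ fromℕ n
fromℕ-+ m n = ℚ.toℚᵘ-injective (begin-equality
  toℚᵘ (fromℕ (m + n))                  ≃⟨ toℚᵘ-fromℕ (m + n) ⟩
  mkℚᵘ (ℤ.+ (m + n)) 0                  ≃⟨ *≡* (cong (ℤ._* ℤ.+ 1) integral) ⟩
  mkℚᵘ (ℤ.+ m) 0 ℚᵘ.+ mkℚᵘ (ℤ.+ n) 0    ≃⟨ ℚᵘ.≃-sym (ℚᵘ.+-cong (toℚᵘ-fromℕ m) (toℚᵘ-fromℕ n)) ⟩
  toℚᵘ (fromℕ m) ℚᵘ.+ toℚᵘ (fromℕ n)    ≃⟨ ℚᵘ.≃-sym (ℚ.toℚᵘ-homo-+ (fromℕ m) (fromℕ n)) ⟩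
  toℚᵘ (fromℕ m ℚ.+ fromℕ n)            ∎)
  where
  open ℚᵘ.≤-Reasoning
  integral : ℤ.+ (m + n) ≡ ℤ.+ m ℤ.* ℤ.+ 1 ℤ.+ ℤ.+ n ℤ.* ℤ.+ 1
  integral = trans (ℤ.pos-+ m n) (sym (cong₂ ℤ._+_ (ℤ.*-identityʳ (ℤ.+ m)) (ℤ.*-identityʳ (ℤ.+ n))))

fromℕ-* : ∀ m n → fromℕ (m ℕ.* n) ≡ fromℕ m * fromℕ n
fromℕ-* m n = ℚ.toℚᵘ-injective (begin-equality
  toℚᵘ (fromℕ (m ℕ.* n))                ≃⟨ toℚᵘ-fromℕ (m ℕ.* n) ⟩
  mkℚᵘ (ℤ.+ (m ℕ.* n)) 0                ≃⟨ *≡* (cong (ℤ._* ℤ.+ 1) (ℤ.pos-* m n)) ⟩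
  mkℚᵘ (ℤ.+ m) 0 ℚᵘ.* mkℚᵘ (ℤ.+ n) 0    ≃⟨ ℚᵘ.≃-sym (ℚᵘ.*-cong (toℚᵘ-fromℕ m) (toℚᵘ-fromℕ n)) ⟩
  toℚᵘ (fromℕ m) ℚᵘ.* toℚᵘ (fromℕ n)    ≃⟨ ℚᵘ.≃-sym (ℚ.toℚᵘ-homo-* (fromℕ m) (fromℕ n)) ⟩
  toℚᵘ (fromℕ m * fromℕ n)              ∎)
  where open ℚᵘ.≤-Reasoning

fromℕ[n!]*invFact[n]≡1 : ∀ n → fromℕ (n !) * invFact n ≡ 1ℚ
fromℕ[n!]*invFact[n]≡1 n = fromℕ*inverse (n !) {{n ℕ.!≢0}}
  where
  fromℕ*inverse : ∀ m .{{_ : ℕ.NonZero m}} → fromℕ m * (ℤ.+ 1 / m) ≡ 1ℚ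
  fromℕ*inverse (suc m) = ℚ.toℚᵘ-injective (begin-equality
    toℚᵘ (fromℕ (suc m) * (ℤ.+ 1 / suc m))          ≃⟨ ℚ.toℚᵘ-homo-* (fromℕ (suc m)) (ℤ.+ 1 / suc m) ⟩
    toℚᵘ (fromℕ (suc m)) ℚᵘ.* toℚᵘ (ℤ.+ 1 / suc m)  ≃⟨ ℚᵘ.*-cong (toℚᵘ-fromℕ (suc m)) (ℚ.toℚᵘ-fromℚᵘ (mkℚᵘ (ℤ.+ 1) m)) ⟩
    mkℚᵘ (ℤ.+ suc m) 0 ℚᵘ.* mkℚᵘ (ℤ.+ 1) m          ≃⟨ *≡* (cong (ℤ.+_ ∘ suc) m*1*1≡m+0+0) ⟩
    toℚᵘ 1ℚ                                         ∎)
    where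
    open ℚᵘ.≤-Reasoning
    m*1*1≡m+0+0 : m ℕ.* 1 ℕ.* 1 ≡ m + 0 + 0
    m*1*1≡m+0+0 = trans (ℕ.*-identityʳ (m ℕ.* 1))
                        (trans (ℕ.*-identityʳ m) (sym (trans (ℕ.+-identityʳ (m + 0)) (ℕ.+-identityʳ m))))

binom-suc-suc : ∀ n k → binom (suc n) (suc k) ≡ binom n k ℚ.+ binom n (suc k)
binom-suc-suc n k = trans (cong fromℕ (sym (nCk+nC[k+1]≡[n+1]C[k+1] n k))) (fromℕ-+ (n C k) (n C suc k))

binom[n,1+n]≡0 : ∀ n → binom n (suc n) ≡ 0ℚ
binom[n,1+n]≡0 n = cong fromℕ (k>n⇒nCk≡0 (ℕ.n<1+n n))

binom[n,n∸k]≡binom[n,k] : ∀ {n k} → k ≤ n → binom n (n ∸ k) ≡ binom n k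
binom[n,n∸k]≡binom[n,k] k≤n = cong fromℕ (sym (nCk≡nC[n∸k] k≤n))

binom*k!*[n∸k]!≡n! : ∀ {n k} → k ≤ n → binom n k * (fromℕ (k !) * fromℕ ((n ∸ k) !)) ≡ fromℕ (n !)
binom*k!*[n∸k]!≡n! {n} {k} k≤n = begin
  binom n k * (fromℕ (k !) * fromℕ ((n ∸ k) !))  ≡⟨ cong (binom n k *_) (fromℕ-* (k !) ((n ∸ k) !)) ⟨
  binom n k * fromℕ (k ! ℕ.* (n ∸ k) !)          ≡⟨ fromℕ-* (n C k) (k ! ℕ.* (n ∸ k) !) ⟨
  fromℕ ((n C k) ℕ.* (k ! ℕ.* (n ∸ k) !))        ≡⟨ cong fromℕ nCk*k!*[n∸k]!≡n! ⟩
  fromℕ (n !)                                    ∎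
  where
  open ≡-Reasoning
  instance _ = k ℕ.!* (n ∸ k) !≢0
  nCk*k!*[n∸k]!≡n! : (n C k) ℕ.* (k ! ℕ.* (n ∸ k) !) ≡ n !
  nCk*k!*[n∸k]!≡n! = trans (cong (ℕ._* (k ! ℕ.* (n ∸ k) !)) (nCk≡n!/k![n-k]! k≤n)) (m/n*n≡m (k![n∸k]!∣n! k≤n))

sumTo-cong : ∀ n {f g : ℕ → ℚ} → (∀ i → i ≤ n → f i ≡ g i) → sumTo n f ≡ sumTo n g
sumTo-cong zero    f≡g = f≡g 0 z≤n
sumTo-cong (suc n) f≡g =
  cong₂ ℚ._+_ (sumTo-cong n (λ i i≤n → f≡g i (ℕ.m≤n⇒m≤1+n i≤n))) (f≡g (suc n) ℕ.≤-refl)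

sumTo-zero : ∀ n {f : ℕ → ℚ} → (∀ i → i ≤ n → f i ≡ 0ℚ) → sumTo n f ≡ 0ℚ
sumTo-zero n {f} f≡0 = trans (sumTo-cong n f≡0) (sumTo-const-0 n)
  where
  sumTo-const-0 : ∀ n → sumTo n (λ _ → 0ℚ) ≡ 0ℚ
  sumTo-const-0 zero    = refl
  sumTo-const-0 (suc n) = cong (ℚ._+ 0ℚ) (sumTo-const-0 n)

sumTo-+ : ∀ n (f g : ℕ → ℚ) → sumTo n (λ i → f i ℚ.+ g i) ≡ sumTo n f ℚ.+ sumTo n g
sumTo-+ zero    f g = refl
sumTo-+ (suc n) f g =
  trans (cong (ℚ._+ (f (suc n) ℚ.+ g (suc n))) (sumTo-+ n f g))
        (solve 4 (λ a b c d → (a :+ b) :+ (c :+ d) := (a :+ c) :+ (b :+ d)) refl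
               (sumTo n f) (sumTo n g) (f (suc n)) (g (suc n)))

*-distribˡ-sumTo : ∀ n c (f : ℕ → ℚ) → c * sumTo n f ≡ sumTo n (λ i → c * f i)
*-distribˡ-sumTo zero    c f = refl
*-distribˡ-sumTo (suc n) c f =
  trans (ℚ.*-distribˡ-+ c (sumTo n f) (f (suc n))) (cong (ℚ._+ c * f (suc n)) (*-distribˡ-sumTo n c f))

*-distribʳ-sumTo : ∀ n c (f : ℕ → ℚ) → sumTo n f * c ≡ sumTo n (λ i → f i * c)
*-distribʳ-sumTo n c f =
  trans (ℚ.*-comm (sumTo n f) c) (trans (*-distribˡ-sumTo n c f) (sumTo-cong n (λ i _ → ℚ.*-comm c (f i))))

neg-distrib-sumTo : ∀ n (f : ℕ → ℚ) → - sumTo n f ≡ sumTo n (λ i → - f i)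
neg-distrib-sumTo zero    f = refl
neg-distrib-sumTo (suc n) f =
  trans (ℚ.neg-distrib-+ (sumTo n f) (f (suc n))) (cong (ℚ._+ - f (suc n)) (neg-distrib-sumTo n f))

sumTo-suc : ∀ n (f : ℕ → ℚ) → sumTo (suc n) f ≡ f 0 ℚ.+ sumTo n (f ∘ suc)
sumTo-suc zero    f = refl
sumTo-suc (suc n) f =
  trans (cong (ℚ._+ f (suc (suc n))) (sumTo-suc n f)) (ℚ.+-assoc (f 0) (sumTo n (f ∘ suc)) (f (suc (suc n))))

sumTo-reverse : ∀ n (f : ℕ → ℚ) → sumTo n f ≡ sumTo n (λ i → f (n ∸ i))
sumTo-reverse zero    f = refl
sumTo-reverse (suc n) f = begin
  sumTo n f ℚ.+ f (suc n)                      ≡⟨ cong (ℚ._+ f (suc n)) (sumTo-reverse n f) ⟩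
  sumTo n (λ i → f (n ∸ i)) ℚ.+ f (suc n)      ≡⟨ ℚ.+-comm (sumTo n (λ i → f (n ∸ i))) (f (suc n)) ⟩
  f (suc n) ℚ.+ sumTo n (λ i → f (n ∸ i))      ≡⟨ sumTo-suc n (λ i → f (suc n ∸ i)) ⟨
  sumTo (suc n) (λ i → f (suc n ∸ i))          ∎
  where open ≡-Reasoning

sumTo-comm : ∀ n m (F : ℕ → ℕ → ℚ) →
             sumTo n (λ i → sumTo m (F i)) ≡ sumTo m (λ j → sumTo n (λ i → F i j))
sumTo-comm zero    m F = refl
sumTo-comm (suc n) m F =
  trans (cong (ℚ._+ sumTo m (F (suc n))) (sumTo-comm n m F))
        (sym (sumTo-+ m (λ j → sumTo n (λ i → F i j)) (F (suc n))))

sumTo-extend : ∀ n d (f : ℕ → ℚ) → (∀ i → n < i → i ≤ d + n → f i ≡ 0ℚ) → sumTo (d + n) f ≡ sumTo n f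
sumTo-extend n zero    f f≡0 = refl
sumTo-extend n (suc d) f f≡0 = begin
  sumTo (d + n) f ℚ.+ f (suc d + n)  ≡⟨ cong₂ ℚ._+_ (sumTo-extend n d f tail≡0) (f≡0 (suc d + n) (s≤s (ℕ.m≤n+m n d)) ℕ.≤-refl) ⟩
  sumTo n f ℚ.+ 0ℚ                   ≡⟨ ℚ.+-identityʳ (sumTo n f) ⟩
  sumTo n f                          ∎
  where
  open ≡-Reasoning
  tail≡0 : ∀ i → n < i → i ≤ d + n → f i ≡ 0ℚ
  tail≡0 i n<i i≤d+n = f≡0 i n<i (ℕ.m≤n⇒m≤1+n i≤d+n)

sumTo-triangle : ∀ n (F : ℕ → ℕ → ℚ) →
                 sumTo n (λ i → sumTo (n ∸ i) (F i)) ≡ sumTo n (λ m → sumTo m (λ i → F i (m ∸ i)))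
sumTo-triangle zero    F = refl
sumTo-triangle (suc n) F = begin
  sumTo n (λ i → sumTo (suc n ∸ i) (F i)) ℚ.+ sumTo (n ∸ n) (F (suc n))
    ≡⟨ cong₂ ℚ._+_ (sumTo-cong n (λ i i≤n → cong (λ m → sumTo m (F i)) (ℕ.+-∸-assoc 1 i≤n)))
                   (cong (λ m → sumTo m (F (suc n))) (ℕ.n∸n≡0 n)) ⟩
  sumTo n (λ i → sumTo (n ∸ i) (F i) ℚ.+ F i (suc (n ∸ i))) ℚ.+ F (suc n) 0
    ≡⟨ cong (ℚ._+ F (suc n) 0) (sumTo-+ n (λ i → sumTo (n ∸ i) (F i)) (λ i → F i (suc (n ∸ i)))) ⟩
  (triangle ℚ.+ diagonal) ℚ.+ F (suc n) 0
    ≡⟨ ℚ.+-assoc triangle diagonal (F (suc n) 0) ⟩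
  triangle ℚ.+ (diagonal ℚ.+ F (suc n) 0)
    ≡⟨ cong₂ ℚ._+_ (sumTo-triangle n F) (cong₂ ℚ._+_ diagonal≡ (cong (F (suc n)) (sym (ℕ.n∸n≡0 n)))) ⟩
  sumTo n (λ m → sumTo m (λ i → F i (m ∸ i))) ℚ.+ sumTo (suc n) (λ i → F i (suc n ∸ i))
    ∎
  where
  open ≡-Reasoning
  triangle diagonal : ℚ
  triangle = sumTo n (λ i → sumTo (n ∸ i) (F i))
  diagonal = sumTo n (λ i → F i (suc (n ∸ i)))
  diagonal≡ : diagonal ≡ sumTo n (λ i → F i (suc n ∸ i))
  diagonal≡ = sumTo-cong n (λ i i≤n → cong (F i) (sym (ℕ.+-∸-assoc 1 i≤n)))

_⊖_ : Series → Series → Series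
(f ⊖ g) n = f n - g n

⊛-cong : ∀ {f f′ g g′ : Series} → f ≗ f′ → g ≗ g′ → f ⊛ g ≗ f′ ⊛ g′
⊛-cong f≗f′ g≗g′ n = sumTo-cong n (λ i _ → cong₂ _*_ (f≗f′ i) (g≗g′ (n ∸ i)))

⊛-congˡ : ∀ (h : Series) {f g : Series} → f ≗ g → f ⊛ h ≗ g ⊛ h
⊛-congˡ h {f} {g} f≗g = ⊛-cong {f} {g} {h} {h} f≗g (λ _ → refl)

⊛-congʳ : ∀ (h : Series) {f g : Series} → f ≗ g → h ⊛ f ≗ h ⊛ g
⊛-congʳ h {f} {g} f≗g = ⊛-cong {h} {h} {f} {g} (λ _ → refl) f≗g

⊛-comm : ∀ (f g : Series) → f ⊛ g ≗ g ⊛ f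
⊛-comm f g n = trans (sumTo-reverse n (λ i → f i * g (n ∸ i)))
  (sumTo-cong n (λ i i≤n → trans (cong (λ j → f (n ∸ i) * g j) (ℕ.m∸[m∸n]≡n i≤n)) (ℚ.*-comm (f (n ∸ i)) (g i))))

⊛-assoc : ∀ (f g h : Series) → (f ⊛ g) ⊛ h ≗ f ⊛ (g ⊛ h)
⊛-assoc f g h n = begin
  sumTo n (λ m → sumTo m (λ i → f i * g (m ∸ i)) * h (n ∸ m))
    ≡⟨ sumTo-cong n (λ m _ → *-distribʳ-sumTo m (h (n ∸ m)) (λ i → f i * g (m ∸ i))) ⟩
  sumTo n (λ m → sumTo m (λ i → f i * g (m ∸ i) * h (n ∸ m)))
    ≡⟨ sumTo-cong n (λ m m≤n → sumTo-cong m (λ i i≤m → reassociate m i m≤n i≤m)) ⟩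
  sumTo n (λ m → sumTo m (λ i → f i * (g (m ∸ i) * h (n ∸ i ∸ (m ∸ i)))))
    ≡⟨ sumTo-triangle n (λ i j → f i * (g j * h (n ∸ i ∸ j))) ⟨
  sumTo n (λ i → sumTo (n ∸ i) (λ j → f i * (g j * h (n ∸ i ∸ j))))
    ≡⟨ sumTo-cong n (λ i _ → *-distribˡ-sumTo (n ∸ i) (f i) (λ j → g j * h (n ∸ i ∸ j))) ⟨
  sumTo n (λ i → f i * sumTo (n ∸ i) (λ j → g j * h (n ∸ i ∸ j)))
    ∎
  where
  open ≡-Reasoning
  reassociate : ∀ m i → m ≤ n → i ≤ m → f i * g (m ∸ i) * h (n ∸ m) ≡ f i * (g (m ∸ i) * h (n ∸ i ∸ (m ∸ i)))
  reassociate m i m≤n i≤m = trans (ℚ.*-assoc (f i) (g (m ∸ i)) (h (n ∸ m)))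
    (cong (λ j → f i * (g (m ∸ i) * h j))
          (sym (trans (ℕ.∸-+-assoc n i (m ∸ i)) (cong (n ∸_) (ℕ.m+[n∸m]≡n i≤m)))))

⊛-identityˡ : ∀ (f : Series) → one ⊛ f ≗ f
⊛-identityˡ f zero    = ℚ.*-identityˡ (f 0)
⊛-identityˡ f (suc n) = begin
  sumTo (suc n) (λ i → one i * f (suc n ∸ i))
    ≡⟨ sumTo-suc n (λ i → one i * f (suc n ∸ i)) ⟩
  1ℚ * f (suc n) ℚ.+ sumTo n (λ i → 0ℚ * f (n ∸ i))
    ≡⟨ cong₂ ℚ._+_ (ℚ.*-identityˡ (f (suc n))) (sumTo-zero n (λ i _ → ℚ.*-zeroˡ (f (n ∸ i)))) ⟩
  f (suc n) ℚ.+ 0ℚ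
    ≡⟨ ℚ.+-identityʳ (f (suc n)) ⟩
  f (suc n)
    ∎
  where open ≡-Reasoning

⊛-identityʳ : ∀ (f : Series) → f ⊛ one ≗ f
⊛-identityʳ f n = trans (⊛-comm f one n) (⊛-identityˡ f n)

⊛-distribʳ-⊖ : ∀ (f g h : Series) → (f ⊖ g) ⊛ h ≗ (f ⊛ h) ⊖ (g ⊛ h)
⊛-distribʳ-⊖ f g h n = begin
  sumTo n (λ i → (f i - g i) * h (n ∸ i))
    ≡⟨ sumTo-cong n (λ i _ → distrib (f i) (g i) (h (n ∸ i))) ⟩
  sumTo n (λ i → f i * h (n ∸ i) ℚ.+ - (g i * h (n ∸ i)))
    ≡⟨ sumTo-+ n (λ i → f i * h (n ∸ i)) (λ i → - (g i * h (n ∸ i))) ⟩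
  (f ⊛ h) n ℚ.+ sumTo n (λ i → - (g i * h (n ∸ i)))
    ≡⟨ cong ((f ⊛ h) n ℚ.+_) (neg-distrib-sumTo n (λ i → g i * h (n ∸ i))) ⟨
  (f ⊛ h) n - (g ⊛ h) n
    ∎
  where
  open ≡-Reasoning
  distrib : ∀ a b c → (a - b) * c ≡ a * c ℚ.+ - (b * c)
  distrib = solve 3 (λ a b c → (a :+ :- b) :* c := a :* c :+ :- (b :* c)) refl

⊛-distribˡ-⊖ : ∀ (f g h : Series) → h ⊛ (f ⊖ g) ≗ (h ⊛ f) ⊖ (h ⊛ g)
⊛-distribˡ-⊖ f g h n =
  trans (⊛-comm h (f ⊖ g) n) (trans (⊛-distribʳ-⊖ f g h n) (cong₂ _-_ (⊛-comm f h n) (⊛-comm g h n)))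

pow-cong : ∀ k {f g : Series} → f ≗ g → pow f k ≗ pow g k
pow-cong zero    f≗g n = refl
pow-cong (suc k) f≗g   = ⊛-cong (pow-cong k f≗g) f≗g

pow-distrib-⊛ : ∀ k (f g : Series) → pow (f ⊛ g) k ≗ pow f k ⊛ pow g k
pow-distrib-⊛ zero    f g n = sym (⊛-identityˡ one n)
pow-distrib-⊛ (suc k) f g = begin
  pow (f ⊛ g) k ⊛ (f ⊛ g)          ≈⟨ ⊛-congˡ (f ⊛ g) (pow-distrib-⊛ k f g) ⟩
  (pow f k ⊛ pow g k) ⊛ (f ⊛ g)    ≈⟨ ⊛-assoc (pow f k) (pow g k) (f ⊛ g) ⟩
  pow f k ⊛ (pow g k ⊛ (f ⊛ g))    ≈⟨ ⊛-congʳ (pow f k) middle ⟩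
  pow f k ⊛ (f ⊛ (pow g k ⊛ g))    ≈⟨ ⊛-assoc (pow f k) f (pow g k ⊛ g) ⟨
  (pow f k ⊛ f) ⊛ (pow g k ⊛ g)    ∎
  where
  open ≗-Reasoning
  middle : pow g k ⊛ (f ⊛ g) ≗ f ⊛ (pow g k ⊛ g)
  middle = begin
    pow g k ⊛ (f ⊛ g)    ≈⟨ ⊛-assoc (pow g k) f g ⟨
    (pow g k ⊛ f) ⊛ g    ≈⟨ ⊛-congˡ g (⊛-comm (pow g k) f) ⟩
    (f ⊛ pow g k) ⊛ g    ≈⟨ ⊛-assoc f (pow g k) g ⟩
    f ⊛ (pow g k ⊛ g)    ∎

shift : ℕ → Series → Series
shift zero    f m       = f m
shift (suc k) f zero    = 0ℚ
shift (suc k) f (suc m) = shift k f m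

shift-cong : ∀ k {f g : Series} → f ≗ g → shift k f ≗ shift k g
shift-cong zero    f≗g m       = f≗g m
shift-cong (suc k) f≗g zero    = refl
shift-cong (suc k) f≗g (suc m) = shift-cong k f≗g m

shift-+ : ∀ k (f : Series) n → shift k f (k + n) ≡ f n
shift-+ zero    f n = refl
shift-+ (suc k) f n = shift-+ k f n

shift-< : ∀ {k m} (f : Series) → m < k → shift k f m ≡ 0ℚ
shift-< {suc k} {zero}  f _         = refl
shift-< {suc k} {suc m} f (s≤s m<k) = shift-< f m<k

shift-shift : ∀ k (f : Series) → shift k (shift 1 f) ≗ shift (suc k) f
shift-shift zero    f m       = refl
shift-shift (suc k) f zero    = refl
shift-shift (suc k) f (suc m) = shift-shift k f m

shift-⊛ : ∀ k (f g : Series) → shift k f ⊛ g ≗ shift k (f ⊛ g)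
shift-⊛ zero    f g n       = refl
shift-⊛ (suc k) f g zero    = ℚ.*-zeroˡ (g 0)
shift-⊛ (suc k) f g (suc n) = begin
  sumTo (suc n) (λ i → shift (suc k) f i * g (suc n ∸ i))
    ≡⟨ sumTo-suc n (λ i → shift (suc k) f i * g (suc n ∸ i)) ⟩
  0ℚ * g (suc n) ℚ.+ (shift k f ⊛ g) n
    ≡⟨ cong₂ ℚ._+_ (ℚ.*-zeroˡ (g (suc n))) (shift-⊛ k f g n) ⟩
  0ℚ ℚ.+ shift k (f ⊛ g) n
    ≡⟨ ℚ.+-identityˡ (shift k (f ⊛ g) n) ⟩
  shift k (f ⊛ g) n
    ∎
  where open ≡-Reasoning

⊛-shift : ∀ k (f g : Series) → f ⊛ shift k g ≗ shift k (f ⊛ g)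
⊛-shift k f g n = trans (⊛-comm f (shift k g) n) (trans (shift-⊛ k g f n) (shift-cong k (⊛-comm g f) n))

pow-shift : ∀ k (f : Series) → pow (shift 1 f) k ≗ shift k (pow f k)
pow-shift zero    f n = refl
pow-shift (suc k) f = begin
  pow (shift 1 f) k ⊛ shift 1 f        ≈⟨ ⊛-congˡ (shift 1 f) (pow-shift k f) ⟩
  shift k (pow f k) ⊛ shift 1 f        ≈⟨ shift-⊛ k (pow f k) (shift 1 f) ⟩
  shift k (pow f k ⊛ shift 1 f)        ≈⟨ shift-cong k (⊛-shift 1 (pow f k) f) ⟩
  shift k (shift 1 (pow f k ⊛ f))      ≈⟨ shift-shift k (pow f k ⊛ f) ⟩
  shift (suc k) (pow f k ⊛ f)          ∎
  where open ≗-Reasoning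

⊛-sumTo : ∀ k (a : ℕ → ℚ) (F : ℕ → Series) (g : Series) →
          (λ m → sumTo k (λ i → a i * F i m)) ⊛ g ≗ (λ m → sumTo k (λ i → a i * (F i ⊛ g) m))
⊛-sumTo k a F g m = begin
  sumTo m (λ j → sumTo k (λ i → a i * F i j) * g (m ∸ j))
    ≡⟨ sumTo-cong m (λ j _ → *-distribʳ-sumTo k (g (m ∸ j)) (λ i → a i * F i j)) ⟩
  sumTo m (λ j → sumTo k (λ i → a i * F i j * g (m ∸ j)))
    ≡⟨ sumTo-comm m k (λ j i → a i * F i j * g (m ∸ j)) ⟩
  sumTo k (λ i → sumTo m (λ j → a i * F i j * g (m ∸ j)))
    ≡⟨ sumTo-cong k (λ i _ → sumTo-cong m (λ j _ → ℚ.*-assoc (a i) (F i j) (g (m ∸ j)))) ⟩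
  sumTo k (λ i → sumTo m (λ j → a i * (F i j * g (m ∸ j))))
    ≡⟨ sumTo-cong k (λ i _ → *-distribˡ-sumTo m (a i) (λ j → F i j * g (m ∸ j))) ⟨
  sumTo k (λ i → a i * (F i ⊛ g) m)
    ∎
  where open ≡-Reasoning

alternatingBinomialSum : ℕ → (ℕ → ℚ) → ℚ
alternatingBinomialSum k P = sumTo k (λ i → binom k i * signPow i * P i)

alternatingBinomialSum-suc : ∀ k (P : ℕ → ℚ) →
  alternatingBinomialSum (suc k) P ≡ alternatingBinomialSum k P - alternatingBinomialSum k (P ∘ suc)
alternatingBinomialSum-suc k P = begin
  sumTo (suc k) (λ i → binom (suc k) i * signPow i * P i)
    ≡⟨ sumTo-suc k (λ i → binom (suc k) i * signPow i * P i) ⟩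
  T 0 ℚ.+ sumTo k (λ i → binom (suc k) (suc i) * signPow (suc i) * P (suc i))
    ≡⟨ cong (T 0 ℚ.+_) (sumTo-cong k (λ i _ → pascal i)) ⟩
  T 0 ℚ.+ sumTo k (λ i → T (suc i) ℚ.+ - (binom k i * signPow i * P (suc i)))
    ≡⟨ cong (T 0 ℚ.+_) (sumTo-+ k (T ∘ suc) (λ i → - (binom k i * signPow i * P (suc i)))) ⟩
  T 0 ℚ.+ (sumTo k (T ∘ suc) ℚ.+ sumTo k (λ i → - (binom k i * signPow i * P (suc i))))
    ≡⟨ cong (λ x → T 0 ℚ.+ (sumTo k (T ∘ suc) ℚ.+ x)) (neg-distrib-sumTo k (λ i → binom k i * signPow i * P (suc i))) ⟨
  T 0 ℚ.+ (sumTo k (T ∘ suc) - alternatingBinomialSum k (P ∘ suc))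
    ≡⟨ ℚ.+-assoc (T 0) (sumTo k (T ∘ suc)) (- alternatingBinomialSum k (P ∘ suc)) ⟨
  (T 0 ℚ.+ sumTo k (T ∘ suc)) - alternatingBinomialSum k (P ∘ suc)
    ≡⟨ cong (_- alternatingBinomialSum k (P ∘ suc)) (sumTo-suc k T) ⟨
  sumTo (suc k) T - alternatingBinomialSum k (P ∘ suc)
    ≡⟨ cong (_- alternatingBinomialSum k (P ∘ suc)) (trans (cong (sumTo k T ℚ.+_) T[1+k]≡0) (ℚ.+-identityʳ (sumTo k T))) ⟩
  alternatingBinomialSum k P - alternatingBinomialSum k (P ∘ suc)
    ∎
  where
  open ≡-Reasoning
  T : ℕ → ℚ
  T i = binom k i * signPow i * P i
  T[1+k]≡0 : T (suc k) ≡ 0ℚ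
  T[1+k]≡0 = trans (cong (λ b → b * signPow (suc k) * P (suc k)) (binom[n,1+n]≡0 k))
                   (trans (ℚ.*-assoc 0ℚ (signPow (suc k)) (P (suc k))) (ℚ.*-zeroˡ (signPow (suc k) * P (suc k))))
  pascal : ∀ i → binom (suc k) (suc i) * signPow (suc i) * P (suc i) ≡ T (suc i) ℚ.+ - (binom k i * signPow i * P (suc i))
  pascal i = trans (cong (λ b → b * signPow (suc i) * P (suc i)) (binom-suc-suc k i))
    (solve 4 (λ a b s p → (a :+ b) :* (:- s) :* p := b :* (:- s) :* p :+ (:- (a :* s :* p))) refl
           (binom k i) (binom k (suc i)) (signPow i) (P (suc i)))

binomial-one⊖ : ∀ k (v : Series) → pow (one ⊖ v) k ≗ (λ m → alternatingBinomialSum k (λ i → pow v i m))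
binomial-one⊖ zero    v m = sym (ℚ.*-identityˡ (one m))
binomial-one⊖ (suc k) v = begin
  pow (one ⊖ v) k ⊛ (one ⊖ v)   ≈⟨ ⊛-congˡ (one ⊖ v) (binomial-one⊖ k v) ⟩
  B k ⊛ (one ⊖ v)               ≈⟨ ⊛-distribˡ-⊖ one v (B k) ⟩
  (B k ⊛ one) ⊖ (B k ⊛ v)       ≈⟨ (λ m → cong₂ _-_ (⊛-identityʳ (B k) m) (⊛-sumTo k a (pow v) v m)) ⟩
  (λ m → alternatingBinomialSum k (λ i → pow v i m) - alternatingBinomialSum k (λ i → pow v (suc i) m))
                                ≈⟨ (λ m → sym (alternatingBinomialSum-suc k (λ i → pow v i m))) ⟩
  B (suc k)                     ∎
  where
  open ≗-Reasoning
  a : ℕ → ℚ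
  a i = binom k i * signPow i
  B : ℕ → Series
  B k m = alternatingBinomialSum k (λ i → pow v i m)

applyUpTo-accumulate : {go : ℕ → List ℕ → List ℕ} →
  (∀ acc → go 0 acc ≡ acc) → (∀ m acc → go (suc m) acc ≡ go m (suc m ∷ acc)) →
  ∀ m acc → go m acc ≡ applyUpTo suc m ++ acc
applyUpTo-accumulate go-zero go-suc zero    acc = go-zero acc
applyUpTo-accumulate {go} go-zero go-suc (suc m) acc = begin
  go (suc m) acc                           ≡⟨ go-suc m acc ⟩
  go m (suc m ∷ acc)                       ≡⟨ applyUpTo-accumulate {go} go-zero go-suc m (suc m ∷ acc) ⟩
  applyUpTo suc m ++ (suc m ∷ acc)         ≡⟨ List.++-assoc (applyUpTo suc m) (suc m ∷ []) acc ⟨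
  (applyUpTo suc m ∷ʳ suc m) ++ acc        ≡⟨ cong (_++ acc) (List.applyUpTo-∷ʳ suc m) ⟩
  applyUpTo suc (suc m) ++ acc             ∎
  where open ≡-Reasoning

length-invRev : ∀ c n → length (invRev c n) ≡ suc n
length-invRev c zero    = refl
length-invRev c (suc n) = cong suc (length-invRev c n)

-- Defs lists the indices 1, …, m with a function local to a where-block, which cannot be named here.
-- Unification recovers it as upFrom1-go, provided it is applied to distinct variables: hence the
-- with-abstractions below, which also hide map c so that it does not compute on either side.
mutual
  upFrom1-go : Series → ℕ → List ℚ → ℕ → ℕ → List ℕ → List ℕ
  upFrom1-go = _

  invSeries-suc-list : ∀ c n → invSeries c (suc n) ≡
    - foldr ℚ._+_ 0ℚ (zipWith _*_ (map c (applyUpTo suc (length (invRev c n)))) (invRev c n))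
  invSeries-suc-list c n with invRev c n | map c
  ... | ds | map-c with length ds
  ... | zero  = refl
  ... | suc l with suc l ∷ [] in acc≡
  ... | acc with suc l in m≡
  ... | m = cong (λ is → - foldr ℚ._+_ 0ℚ (zipWith _*_ (map-c is) ds)) (begin
    upFrom1-go c n ds m l acc       ≡⟨ applyUpTo-accumulate {upFrom1-go c n ds m} (λ _ → refl) (λ _ _ → refl) l acc ⟩
    applyUpTo suc l ++ acc          ≡⟨ cong (applyUpTo suc l ++_) (sym acc≡) ⟩
    applyUpTo suc l ∷ʳ m            ≡⟨ cong (applyUpTo suc l ∷ʳ_) (sym m≡) ⟩
    applyUpTo suc l ∷ʳ suc l        ≡⟨ List.applyUpTo-∷ʳ suc l ⟩
    applyUpTo suc (suc l)           ∎)
    where open ≡-Reasoning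

invRev≡applyDownFrom : ∀ c n → invRev c n ≡ applyDownFrom (invSeries c) (suc n)
invRev≡applyDownFrom c zero    = refl
invRev≡applyDownFrom c (suc n) = cong (invSeries c (suc n) ∷_) (invRev≡applyDownFrom c n)

foldr-zipWith≡⊛ : ∀ m (f g : Series) →
  foldr ℚ._+_ 0ℚ (zipWith _*_ (applyUpTo f (suc m)) (applyDownFrom g (suc m))) ≡ (f ⊛ g) m
foldr-zipWith≡⊛ zero    f g = ℚ.+-identityʳ (f 0 * g 0)
foldr-zipWith≡⊛ (suc m) f g =
  trans (cong (f 0 * g (suc m) ℚ.+_) (foldr-zipWith≡⊛ m (f ∘ suc) g))
        (sym (sumTo-suc m (λ i → f i * g (suc m ∸ i))))

invSeries-suc : ∀ c n → invSeries c (suc n) ≡ - ((c ∘ suc) ⊛ invSeries c) n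
invSeries-suc c n = begin
  invSeries c (suc n)
    ≡⟨ invSeries-suc-list c n ⟩
  -Σ (map c (applyUpTo suc (length (invRev c n)))) (invRev c n)
    ≡⟨ cong₂ (λ L → -Σ (map c (applyUpTo suc L))) (length-invRev c n) (invRev≡applyDownFrom c n) ⟩
  -Σ (map c (applyUpTo suc (suc n))) (applyDownFrom (invSeries c) (suc n))
    ≡⟨ cong (λ cs → -Σ cs (applyDownFrom (invSeries c) (suc n))) (List.map-applyUpTo suc c (suc n)) ⟩
  -Σ (applyUpTo (c ∘ suc) (suc n)) (applyDownFrom (invSeries c) (suc n))
    ≡⟨ cong -_ (foldr-zipWith≡⊛ n (c ∘ suc) (invSeries c)) ⟩
  - ((c ∘ suc) ⊛ invSeries c) n
    ∎
  where
  open ≡-Reasoning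
  -Σ : List ℚ → List ℚ → ℚ
  -Σ cs ds = - foldr ℚ._+_ 0ℚ (zipWith _*_ cs ds)

⊛-invSeries : ∀ c → c 0 ≡ 1ℚ → c ⊛ invSeries c ≗ one
⊛-invSeries c c0≡1 zero    = cong (_* 1ℚ) c0≡1
⊛-invSeries c c0≡1 (suc n) = begin
  sumTo (suc n) (λ i → c i * invSeries c (suc n ∸ i))   ≡⟨ sumTo-suc n (λ i → c i * invSeries c (suc n ∸ i)) ⟩
  c 0 * invSeries c (suc n) ℚ.+ rest                    ≡⟨ cong₂ (λ a b → a * b ℚ.+ rest) c0≡1 (invSeries-suc c n) ⟩
  1ℚ * - rest ℚ.+ rest                                  ≡⟨ cong (ℚ._+ rest) (ℚ.*-identityˡ (- rest)) ⟩
  - rest ℚ.+ rest                                       ≡⟨ ℚ.+-inverseˡ rest ⟩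
  0ℚ                                                    ∎
  where
  open ≡-Reasoning
  rest : ℚ
  rest = ((c ∘ suc) ⊛ invSeries c) n

bernoulliGF : ℚ → Series
bernoulliGF λ' = invSeries (eλ-1/t λ')

eλ-1-t≗shift : ∀ λ' → eλ-1-t λ' ≗ shift 1 (eλ-1/t λ' ⊖ one)
eλ-1-t≗shift λ' zero          = refl
eλ-1-t≗shift λ' (suc zero)    = refl
eλ-1-t≗shift λ' (suc (suc m)) = sym (ℚ.+-identityʳ (eλ λ' (suc (suc m))))

bernoulliGF⊛eλ-1-t : ∀ λ' → bernoulliGF λ' ⊛ eλ-1-t λ' ≗ shift 1 (one ⊖ bernoulliGF λ')
bernoulliGF⊛eλ-1-t λ' = begin
  u ⊛ eλ-1-t λ'                  ≈⟨ ⊛-congʳ u (eλ-1-t≗shift λ') ⟩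
  u ⊛ shift 1 (h ⊖ one)          ≈⟨ ⊛-shift 1 u (h ⊖ one) ⟩
  shift 1 (u ⊛ (h ⊖ one))        ≈⟨ shift-cong 1 (⊛-distribˡ-⊖ h one u) ⟩
  shift 1 ((u ⊛ h) ⊖ (u ⊛ one))  ≈⟨ shift-cong 1 (λ m → cong₂ _-_ (u⊛h≗one m) (⊛-identityʳ u m)) ⟩
  shift 1 (one ⊖ u)              ∎
  where
  open ≗-Reasoning
  h u : Series
  h = eλ-1/t λ'
  u = bernoulliGF λ'
  h[0]≡1 : h 0 ≡ 1ℚ
  h[0]≡1 = cong (λ x → 1ℚ * (1ℚ - x) * invFact 1) (ℚ.*-zeroˡ λ')
  u⊛h≗one : u ⊛ h ≗ one
  u⊛h≗one m = trans (⊛-comm u h m) (⊛-invSeries h h[0]≡1 m)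

pow-eλ-1-t-< : ∀ λ' {k m} → m < k → pow (eλ-1-t λ') k m ≡ 0ℚ
pow-eλ-1-t-< λ' {k} {m} m<k = begin
  pow (eλ-1-t λ') k m                        ≡⟨ pow-cong k (eλ-1-t≗shift λ') m ⟩
  pow (shift 1 (eλ-1/t λ' ⊖ one)) k m        ≡⟨ pow-shift k (eλ-1/t λ' ⊖ one) m ⟩
  shift k (pow (eλ-1/t λ' ⊖ one) k) m        ≡⟨ shift-< (pow (eλ-1/t λ' ⊖ one) k) m<k ⟩
  0ℚ                                         ∎
  where open ≡-Reasoning

pow-bernoulliGF⊛pow-eλ-1-t : ∀ λ' k →
  pow (bernoulliGF λ') k ⊛ pow (eλ-1-t λ') k ≗ shift k (pow (one ⊖ bernoulliGF λ') k)
pow-bernoulliGF⊛pow-eλ-1-t λ' k = begin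
  pow u k ⊛ pow (eλ-1-t λ') k           ≈⟨ pow-distrib-⊛ k u (eλ-1-t λ') ⟨
  pow (u ⊛ eλ-1-t λ') k                 ≈⟨ pow-cong k (bernoulliGF⊛eλ-1-t λ') ⟩
  pow (shift 1 (one ⊖ u)) k             ≈⟨ pow-shift k (one ⊖ u) ⟩
  shift k (pow (one ⊖ u) k)             ∎
  where
  open ≗-Reasoning
  u : Series
  u = bernoulliGF λ'

⊛-truncate : ∀ n k (f g : Series) → (∀ m → m < k → g m ≡ 0ℚ) →
             (f ⊛ g) (n + k) ≡ sumTo n (λ j → f j * g (n + k ∸ j))
⊛-truncate n k f g g≡0 = trans (cong (λ N → sumTo N F) (ℕ.+-comm n k)) (sumTo-extend n k F F≡0)
  where
  F : ℕ → ℚ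
  F j = f j * g (n + k ∸ j)
  F≡0 : ∀ i → n < i → i ≤ k + n → F i ≡ 0ℚ
  F≡0 i n<i i≤k+n = trans (cong (f i *_) (g≡0 (n + k ∸ i) n+k∸i<k)) (ℚ.*-zeroʳ (f i))
    where
    n+k∸i<k : n + k ∸ i < k
    n+k∸i<k = subst (n + k ∸ i <_) (ℕ.m+n∸m≡n n k)
                (ℕ.∸-monoʳ-< n<i (subst (i ≤_) (ℕ.+-comm k n) i≤k+n))

S22*binom*β≡⊛-term : ∀ λ' {n k j} → j ≤ n →
  S22 λ' (n ∸ j + k) k * binom (n + k) j * β λ' k j
    ≡ fromℕ ((n + k) !) * invFact k * (pow (bernoulliGF λ') k j * pow (eλ-1-t λ') k (n + k ∸ j))
S22*binom*β≡⊛-term λ' {n} {k} {j} j≤n = begin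
  fromℕ ((n ∸ j + k) !) * (invFact k * G (n ∸ j + k)) * binom N j * (fromℕ (j !) * U j)
    ≡⟨ cong (λ m → fromℕ (m !) * (invFact k * G m) * binom N j * (fromℕ (j !) * U j)) (ℕ.+-∸-comm k j≤n) ⟨
  fromℕ ((N ∸ j) !) * (invFact k * G (N ∸ j)) * binom N j * (fromℕ (j !) * U j)
    ≡⟨ solve 6 (λ a i g b c u → a :* (i :* g) :* b :* (c :* u) := b :* (c :* a) :* i :* (u :* g)) refl
             (fromℕ ((N ∸ j) !)) (invFact k) (G (N ∸ j)) (binom N j) (fromℕ (j !)) (U j) ⟩
  binom N j * (fromℕ (j !) * fromℕ ((N ∸ j) !)) * invFact k * (U j * G (N ∸ j))
    ≡⟨ cong (λ x → x * invFact k * (U j * G (N ∸ j))) (binom*k!*[n∸k]!≡n! (ℕ.≤-trans j≤n (ℕ.m≤m+n n k))) ⟩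
  fromℕ (N !) * invFact k * (U j * G (N ∸ j))
    ∎
  where
  open ≡-Reasoning
  N : ℕ
  N = n + k
  G U : Series
  G = pow (eλ-1-t λ') k
  U = pow (bernoulliGF λ') k

[n+k]!/k!≡binom*n! : ∀ n k → fromℕ ((n + k) !) * invFact k ≡ binom (n + k) k * fromℕ (n !)
[n+k]!/k!≡binom*n! n k = begin
  fromℕ ((n + k) !) * invFact k
    ≡⟨ cong (_* invFact k) (binom*k!*[n∸k]!≡n! (ℕ.m≤n+m k n)) ⟨
  binom (n + k) k * (fromℕ (k !) * fromℕ ((n + k ∸ k) !)) * invFact k
    ≡⟨ cong (λ m → binom (n + k) k * (fromℕ (k !) * fromℕ (m !)) * invFact k) (ℕ.m+n∸n≡m n k) ⟩
  binom (n + k) k * (fromℕ (k !) * fromℕ (n !)) * invFact k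
    ≡⟨ solve 4 (λ b a c i → b :* (a :* c) :* i := b :* c :* (a :* i)) refl
             (binom (n + k) k) (fromℕ (k !)) (fromℕ (n !)) (invFact k) ⟩
  binom (n + k) k * fromℕ (n !) * (fromℕ (k !) * invFact k)
    ≡⟨ cong (binom (n + k) k * fromℕ (n !) *_) (fromℕ[n!]*invFact[n]≡1 k) ⟩
  binom (n + k) k * fromℕ (n !) * 1ℚ
    ≡⟨ ℚ.*-identityʳ (binom (n + k) k * fromℕ (n !)) ⟩
  binom (n + k) k * fromℕ (n !)
    ∎
  where open ≡-Reasoning

alternatingBinomialSum-reverse : ∀ k (P : ℕ → ℚ) →
  sumTo k (λ j → binom k j * signPow (k ∸ j) * P (k ∸ j)) ≡ alternatingBinomialSum k P
alternatingBinomialSum-reverse k P =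
  trans (sumTo-reverse k (λ j → binom k j * signPow (k ∸ j) * P (k ∸ j)))
        (sumTo-cong k (λ i i≤k → trans (cong (λ m → binom k (k ∸ i) * signPow m * P m) (ℕ.m∸[m∸n]≡n i≤k))
                                        (cong (λ b → b * signPow i * P i) (binom[n,n∸k]≡binom[n,k] i≤k))))

sumTo-binom*signPow*β : ∀ λ' n k →
  sumTo k (λ j → binom k j * signPow (k ∸ j) * β λ' (k ∸ j) n) ≡ fromℕ (n !) * pow (one ⊖ bernoulliGF λ') k n
sumTo-binom*signPow*β λ' n k = begin
  sumTo k (λ j → binom k j * signPow (k ∸ j) * (fromℕ (n !) * pow u (k ∸ j) n))
    ≡⟨ sumTo-cong k (λ j _ → solve 4 (λ b s c p → b :* s :* (c :* p) := c :* (b :* s :* p)) refl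
                                     (binom k j) (signPow (k ∸ j)) (fromℕ (n !)) (pow u (k ∸ j) n)) ⟩
  sumTo k (λ j → fromℕ (n !) * (binom k j * signPow (k ∸ j) * pow u (k ∸ j) n))
    ≡⟨ *-distribˡ-sumTo k (fromℕ (n !)) (λ j → binom k j * signPow (k ∸ j) * pow u (k ∸ j) n) ⟨
  fromℕ (n !) * sumTo k (λ j → binom k j * signPow (k ∸ j) * pow u (k ∸ j) n)
    ≡⟨ cong (fromℕ (n !) *_) (alternatingBinomialSum-reverse k (λ i → pow u i n)) ⟩
  fromℕ (n !) * alternatingBinomialSum k (λ i → pow u i n)
    ≡⟨ cong (fromℕ (n !) *_) (binomial-one⊖ k u n) ⟨
  fromℕ (n !) * pow (one ⊖ u) k n
    ∎
  where
  open ≡-Reasoning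
  u : Series
  u = bernoulliGF λ'

theorem7 : (λ' : ℚ) → λ' ≢ 0ℚ → (n k : ℕ) →
  sumTo n (λ j → S22 λ' (n ∸ j + k) k * binom (n + k) j * β λ' k j)
    ≡ binom (n + k) k * sumTo k (λ j → binom k j * signPow (k ∸ j) * β λ' (k ∸ j) n)
theorem7 λ' _ n k = begin
  sumTo n (λ j → S22 λ' (n ∸ j + k) k * binom (n + k) j * β λ' k j)
    ≡⟨ sumTo-cong n (λ j j≤n → S22*binom*β≡⊛-term λ' j≤n) ⟩
  sumTo n (λ j → c * (U j * G (n + k ∸ j)))
    ≡⟨ *-distribˡ-sumTo n c (λ j → U j * G (n + k ∸ j)) ⟨
  c * sumTo n (λ j → U j * G (n + k ∸ j))
    ≡⟨ cong (c *_) (⊛-truncate n k U G (λ m → pow-eλ-1-t-< λ')) ⟨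
  c * (U ⊛ G) (n + k)
    ≡⟨ cong (c *_) (trans (pow-bernoulliGF⊛pow-eλ-1-t λ' k (n + k)) shift-at-n+k) ⟩
  c * pow (one ⊖ bernoulliGF λ') k n
    ≡⟨ cong (_* pow (one ⊖ bernoulliGF λ') k n) ([n+k]!/k!≡binom*n! n k) ⟩
  binom (n + k) k * fromℕ (n !) * pow (one ⊖ bernoulliGF λ') k n
    ≡⟨ ℚ.*-assoc (binom (n + k) k) (fromℕ (n !)) (pow (one ⊖ bernoulliGF λ') k n) ⟩
  binom (n + k) k * (fromℕ (n !) * pow (one ⊖ bernoulliGF λ') k n)
    ≡⟨ cong (binom (n + k) k *_) (sumTo-binom*signPow*β λ' n k) ⟨
  binom (n + k) k * sumTo k (λ j → binom k j * signPow (k ∸ j) * β λ' (k ∸ j) n)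
    ∎
  where
  open ≡-Reasoning
  c : ℚ
  c = fromℕ ((n + k) !) * invFact k
  U G : Series
  U = pow (bernoulliGF λ') k
  G = pow (eλ-1-t λ') k
  shift-at-n+k : shift k (pow (one ⊖ bernoulliGF λ') k) (n + k) ≡ pow (one ⊖ bernoulliGF λ') k n
  shift-at-n+k = trans (cong (shift k _) (ℕ.+-comm n k)) (shift-+ k _ n)
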